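{- Let $T$ be a tree (in a graph with vertex costs $c\ge0$ and vertex prizes $\pi\ge0$) with prize-to-cost ratio $\gamma$, and let $B$ be a real number such that $c(T)\ge \frac{B}{2}$ and every vertex of $T$ has cost at most $\frac{B}{2}$. Then one can find a subtree $T^*\subseteq T$ with prize-to-cost ratio at least $\frac{\gamma}{4}$ such that $\frac{B}{4}\le c(T^*)\le B$.
   Context: For a set of vertices (or subgraph) $U$, $c(U)$ and $\pi(U)$ denote the total cost and prize of its vertices; the prize-to-cost ratio of $U$ is $\pi(U)/c(U)$. A subtree of $T$ here means a connected subgraph of $T$.
   Formalization: The vertex costs c, the vertex prizes π and the bound B are rational rather than real. -}

module Defs where

open import Data.Nat using (ℕ; suc)
import Data.Nat as ℕ
open import Data.Bool using (Bool; true; false; if_then_else_)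
open import Data.Fin using (Fin)
open import Data.Fin.Subset using (Subset; _∈_; Nonempty)
open import Data.List using (List; []; _∷_; _∷ʳ_; length; foldr; allFin)
open import Data.List.Relation.Unary.Linked using (Linked)
open import Data.List.Relation.Unary.Unique.Propositional using (Unique)
open import Data.Integer using (+_)
open import Data.Rational using (ℚ; _+_; _*_; _/_; 0ℚ)
open import Data.Vec using (lookup; replicate)
open import Data.Product using (Σ; _×_; ∃)
open import Relation.Binary.PropositionalEquality using (_≡_)
open import Relation.Nullary using (¬_)

record SimpleGraph (n : ℕ) : Set where
  field
    adj    : Fin n → Fin n → Bool
    sym    : ∀ i j → adj i j ≡ adj j i
    irrefl : ∀ i → adj i i ≡ false

module _ {n : ℕ} (G : SimpleGraph n) where
  open SimpleGraph G

  Adj : Fin n → Fin n → Set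
  Adj i j = adj i j ≡ true

  data WalkIn (S : Subset n) : Fin n → Fin n → Set where
    here : ∀ {u} → u ∈ S → WalkIn S u u
    step : ∀ {u w v} → u ∈ S → Adj u w → WalkIn S w v → WalkIn S u v

  ConnectedOn : Subset n → Set
  ConnectedOn S = Nonempty S × (∀ u v → u ∈ S → v ∈ S → WalkIn S u v)

  HasCycle : Set
  HasCycle = Σ (Fin n) λ u → Σ (List (Fin n)) λ rest →
    (2 ℕ.≤ length rest) × Unique (u ∷ rest) × Linked Adj ((u ∷ rest) ∷ʳ u)

  IsTree : Set
  IsTree = ConnectedOn (replicate n true) × ¬ HasCycle

weight : {n : ℕ} → (Fin n → ℚ) → Subset n → ℚ
weight {n} w S = foldr (λ i acc → (if lookup S i then w i else 0ℚ) + acc) 0ℚ (allFin n)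


two four : ℚ
two = + 2 / 1
four = + 4 / 1

-- Put a = B/4: every vertex costs at most 2a and T costs at least 2a. Root a spanning
-- tree of T. While the current subtree costs more than 4a, cut a connected piece of
-- cost between a and 4a off it: descend into a child subtree costing more than 3a if
-- there is one, take a child subtree costing between a and 3a whole, and if all
-- children cost less than a, take the root together with a final run of children
-- costing between a and 2a. Piece and remainder share at most the root, which costs at
-- most three quarters of the piece, so 4·c(remainder) + c(piece) ≤ 4·c(subtree), and
-- the remainder still costs at least a. Hence if the piece has prize-to-cost ratio
-- below a quarter of the subtree's, the remainder keeps the subtree's ratio; so
-- starting from ratio γ, either some piece has ratio at least γ/4, or the process
-- reaches a subtree of cost at most 4a and ratio at least γ.
module Submission where

open import Defs
open import Level using (0ℓ)
open import Data.Bool using (Bool; true; if_then_else_)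
open import Data.Nat as ℕ using (ℕ; s≤s; z≤n)
import Data.Nat.Properties as ℕ
open import Data.Nat.Induction using (<-wellFounded)
import Data.Integer as ℤ
open import Data.Rational using (ℚ; _≤_; _<_; _+_; _*_; _/_; 0ℚ; nonNegative)
open import Data.Rational.Properties
open import Data.Product using (Σ; _×_; _,_; proj₁; proj₂; ∃; ∃₂)
open import Data.Sum as Sum using (_⊎_; inj₁; inj₂)
open import Data.Maybe using (nothing)
open import Data.Fin using (Fin) renaming (_≟_ to _≟ᶠ_)
open import Data.Fin.Properties using (all?; ¬∀⟶∃¬)
open import Data.Fin.Subset using (Subset) renaming (_∈_ to _∈ₛ_)
open import Data.Fin.Subset.Properties using (∈⊤)
open import Data.Vec using (replicate; tabulate; lookup)
open import Data.Vec.Properties using (lookup∘tabulate; lookup-replicate; []=⇒lookup; lookup⇒[]=)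
open import Data.List using (List; []; _∷_; _++_; length; foldr; allFin)
open import Data.List.Properties using (length-++; length-++-sucʳ; length-++-≤ˡ; length-++-≤ʳ; ++-assoc)
open import Data.List.Membership.Propositional using (_∈_; _∉_)
open import Data.List.Membership.Propositional.Properties using (∈-++⁺ˡ; ∈-++⁺ʳ; ∈-++⁻; ∈-allFin)
open import Data.List.Relation.Unary.Any using (here; there)
open import Data.List.Relation.Unary.All using (All)
import Data.List.Relation.Unary.All.Properties as Allₚ
open import Data.List.Relation.Unary.All.Properties using (¬Any⇒All¬)
open import Data.List.Relation.Unary.Unique.Propositional using (Unique)
open import Data.List.Relation.Unary.Unique.Propositional.Properties using (Unique[x∷xs]⇒x∉xs; allFin⁺)
open import Data.List.Relation.Binary.Sublist.Propositional using (_⊆_; ⊆-refl; ⊆-trans)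
open import Data.List.Relation.Binary.Sublist.Propositional.Properties using (++⁺; ++⁺ˡ; ++⁺ʳ; All-resp-⊆)
open import Data.List.Relation.Binary.Permutation.Propositional
  using (_↭_; prep; swap; ↭-sym; ↭-trans; ↭⇒↭ₛ) renaming (refl to ↭-refl)
import Data.List.Relation.Binary.Permutation.Propositional.Properties as ↭
import Data.List.Relation.Binary.Permutation.Setoid.Properties as ↭ₛ
open import Induction.WellFounded using (Acc; acc)
open import Relation.Nullary using (yes; no; does; contradiction)
open import Relation.Nullary.Decidable using (dec-true)
open import Relation.Binary.Definitions using (DecidableEquality)
open import Relation.Binary.PropositionalEquality
  using (_≡_; refl; cong; cong₂; sym; trans; subst; subst₂; module ≡-Reasoning)
open import Relation.Binary.PropositionalEquality.Properties using (setoid)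
open import Algebra.Bundles using (CommutativeMonoid)
open import Algebra.Properties.CommutativeSemigroup (CommutativeMonoid.commutativeSemigroup +-0-commutativeMonoid)
  using () renaming (interchange to +-interchange)
open import Tactic.RingSolver using (solve)
open import Tactic.RingSolver.Core.AlmostCommutativeRing using (AlmostCommutativeRing; fromCommutativeRing)

ringℚ : AlmostCommutativeRing 0ℓ 0ℓ
ringℚ = fromCommutativeRing +-*-commutativeRing (λ _ → nothing)

three : ℚ
three = ℤ.+ 3 / 1

x≤x+y : ∀ {x y} → 0ℚ ≤ y → x ≤ x + y
x≤x+y {x} 0≤y = ≤-trans (≤-reflexive (sym (+-identityʳ x))) (+-monoʳ-≤ x 0≤y)

x≤y+x : ∀ {x y} → 0ℚ ≤ y → x ≤ y + x
x≤y+x {x} {y} 0≤y = ≤-trans (x≤x+y 0≤y) (≤-reflexive (+-comm x y))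

four*[x*¼]≡x : ∀ x → four * (x * (ℤ.+ 1 / 4)) ≡ x
four*[x*¼]≡x x = solve (x ∷ []) ringℚ

two*[two*x]≡four*x : ∀ x → two * (two * x) ≡ four * x
two*[two*x]≡four*x x = solve (x ∷ []) ringℚ

x≤four*x : ∀ {x} → 0ℚ ≤ x → x ≤ four * x
x≤four*x {x} 0≤x = begin
  x                  ≤⟨ x≤x+y (+-mono-≤ (+-mono-≤ 0≤x 0≤x) 0≤x) ⟩
  x + (x + x + x)    ≡⟨ solve (x ∷ []) ringℚ ⟩
  four * x           ∎
  where open ≤-Reasoning

three*x≤four*x : ∀ {x} → 0ℚ ≤ x → three * x ≤ four * x
three*x≤four*x {x} 0≤x = begin
  three * x       ≤⟨ x≤x+y 0≤x ⟩
  three * x + x   ≡⟨ solve (x ∷ []) ringℚ ⟩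
  four * x        ∎
  where open ≤-Reasoning

two*x≤three*x : ∀ {x} → 0ℚ ≤ x → two * x ≤ three * x
two*x≤three*x {x} 0≤x = begin
  two * x       ≤⟨ x≤x+y 0≤x ⟩
  two * x + x   ≡⟨ solve (x ∷ []) ringℚ ⟩
  three * x     ∎
  where open ≤-Reasoning

two*x≤four*x : ∀ {x} → 0ℚ ≤ x → two * x ≤ four * x
two*x≤four*x 0≤x = ≤-trans (two*x≤three*x 0≤x) (three*x≤four*x 0≤x)

x<a⇒y≤a⇒x+y<two*a : ∀ {a x y} → x < a → y ≤ a → x + y < two * a
x<a⇒y≤a⇒x+y<two*a {a} x<a y≤a =
  <-≤-trans (+-mono-<-≤ x<a y≤a) (≤-reflexive (solve (a ∷ []) ringℚ))

x≤two*a⇒y≤two*a⇒x+y≤four*a : ∀ {a x y} → x ≤ two * a → y ≤ two * a → x + y ≤ four * a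
x≤two*a⇒y≤two*a⇒x+y≤four*a {a} x≤2a y≤2a =
  ≤-trans (+-mono-≤ x≤2a y≤2a) (≤-reflexive (solve (a ∷ []) ringℚ))

three*a<x+y⇒x≤two*a⇒a<y : ∀ {a x y} → three * a < x + y → x ≤ two * a → a < y
three*a<x+y⇒x≤two*a⇒a<y {a} {x} {y} 3a<x+y x≤2a with a <? y
... | yes a<y = a<y
... | no y≤a  = contradiction (<-≤-trans 3a<x+y x+y≤3a) (<-irrefl refl)
  where
  x+y≤3a : x + y ≤ three * a
  x+y≤3a = begin
    x + y         ≤⟨ +-mono-≤ x≤2a (≮⇒≥ y≤a) ⟩
    two * a + a   ≡⟨ solve (a ∷ []) ringℚ ⟩
    three * a     ∎
    where open ≤-Reasoning

four*a<x⇒x≤y+three*a⇒a≤y : ∀ {a x y} → four * a < x → x ≤ y + three * a → a ≤ y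
four*a<x⇒x≤y+three*a⇒a≤y {a} {x} {y} 4a<x x≤y+3a with a ≤? y
... | yes a≤y = a≤y
... | no y<a  = contradiction (<-≤-trans 4a<x x≤4a) (<-irrefl refl)
  where
  x≤4a : x ≤ four * a
  x≤4a = begin
    x               ≤⟨ x≤y+3a ⟩
    y + three * a   ≤⟨ +-monoˡ-≤ (three * a) (<⇒≤ (≰⇒> y<a)) ⟩
    a + three * a   ≡⟨ solve (a ∷ []) ringℚ ⟩
    four * a        ∎
    where open ≤-Reasoning

0≤x⇒0≤y⇒0≤x*y : ∀ {x y} → 0ℚ ≤ x → 0ℚ ≤ y → 0ℚ ≤ x * y
0≤x⇒0≤y⇒0≤x*y {x} 0≤x 0≤y =
  ≤-trans (≤-reflexive (sym (*-zeroʳ x))) (*-monoˡ-≤-nonNeg x {{nonNegative 0≤x}} 0≤y)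

x*y≤four*y*x : ∀ {x y} → 0ℚ ≤ x → 0ℚ ≤ y → x * y ≤ four * y * x
x*y≤four*y*x {x} {y} 0≤x 0≤y =
  ≤-trans (x≤four*x (0≤x⇒0≤y⇒0≤x*y 0≤x 0≤y)) (≤-reflexive (solve (x ∷ y ∷ []) ringℚ))

module _ {p q : ℚ} (0≤p : 0ℚ ≤ p) (0≤q : 0ℚ ≤ q) where

  ratio-inherited : ∀ {C C′ Cₚ P P′ Pₚ} → four * C′ + Cₚ ≤ four * C → P ≤ P′ + Pₚ →
    p * C ≤ q * P → four * Pₚ * q < p * Cₚ → p * C′ ≤ q * P′
  ratio-inherited {C} {C′} {Cₚ} {P} {P′} {Pₚ} key cover ratio piece-poor with p * C′ ≤? q * P′
  ... | yes ok = ok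
  ... | no worse = contradiction absurd (<-irrefl refl)
    where
    open ≤-Reasoning
    absurd : four * (q * P) < four * (q * P)
    absurd = begin-strict
      four * (q * P)                    ≤⟨ *-monoˡ-≤-nonNeg four (*-monoˡ-≤-nonNeg q {{nonNegative 0≤q}} cover) ⟩
      four * (q * (P′ + Pₚ))            ≡⟨ solve (q ∷ P′ ∷ Pₚ ∷ []) ringℚ ⟩
      four * (q * P′) + four * Pₚ * q   <⟨ +-mono-< (*-monoʳ-<-pos four (≰⇒> worse)) piece-poor ⟩
      four * (p * C′) + p * Cₚ          ≡⟨ solve (p ∷ C′ ∷ Cₚ ∷ []) ringℚ ⟩
      p * (four * C′ + Cₚ)              ≤⟨ *-monoˡ-≤-nonNeg p {{nonNegative 0≤p}} key ⟩
      p * (four * C)                    ≡⟨ solve (p ∷ C ∷ []) ringℚ ⟩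
      four * (p * C)                    ≤⟨ *-monoˡ-≤-nonNeg four ratio ⟩
      four * (q * P)                    ∎

module _ (a : ℚ) where

  -- A part of cost C and prize P splits into a remainder (C′, P′) and a piece (Cₚ, Pₚ)
  -- which may share with it one vertex of cost at most 3Cₚ/4; hence cost-key.
  record Balance (C C′ Cₚ P P′ Pₚ : ℚ) : Set where
    field
      cost-key    : four * C′ + Cₚ ≤ four * C
      cost-drop   : C ≤ C′ + three * a
      prize-cover : P ≤ P′ + Pₚ

  module _ {C C′ Cₚ P P′ Pₚ : ℚ} where
    open ≤-Reasoning

    Balance-shiftˡ : ∀ k l → Balance C C′ Cₚ P P′ Pₚ →
      Balance (k + C) (k + C′) Cₚ (l + P) (l + P′) Pₚ
    Balance-shiftˡ k l b = record
      { cost-key    = begin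
          four * (k + C′) + Cₚ          ≡⟨ solve (k ∷ C′ ∷ Cₚ ∷ []) ringℚ ⟩
          four * k + (four * C′ + Cₚ)   ≤⟨ +-monoʳ-≤ (four * k) cost-key ⟩
          four * k + four * C           ≡⟨ *-distribˡ-+ four k C ⟨
          four * (k + C)                ∎
      ; cost-drop   = ≤-trans (+-monoʳ-≤ k cost-drop) (≤-reflexive (sym (+-assoc k C′ (three * a))))
      ; prize-cover = ≤-trans (+-monoʳ-≤ l prize-cover) (≤-reflexive (sym (+-assoc l P′ Pₚ)))
      }
      where open Balance b

    Balance-shiftʳ : ∀ k l → Balance C C′ Cₚ P P′ Pₚ →
      Balance (C + k) (C′ + k) Cₚ (P + l) (P′ + l) Pₚ
    Balance-shiftʳ k l b rewrite +-comm C k | +-comm C′ k | +-comm P l | +-comm P′ l = Balance-shiftˡ k l b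

  module _ {Cₚ C′ Pₚ P′ : ℚ} where
    open ≤-Reasoning

    Balance-detach : 0ℚ ≤ Cₚ → Cₚ ≤ three * a → Balance (Cₚ + C′) C′ Cₚ (Pₚ + P′) P′ Pₚ
    Balance-detach 0≤Cₚ Cₚ≤3a = record
      { cost-key    = begin
          four * C′ + Cₚ          ≤⟨ +-monoʳ-≤ (four * C′) (x≤four*x 0≤Cₚ) ⟩
          four * C′ + four * Cₚ   ≡⟨ solve (C′ ∷ Cₚ ∷ []) ringℚ ⟩
          four * (Cₚ + C′)        ∎
      ; cost-drop   = ≤-trans (≤-reflexive (+-comm Cₚ C′)) (+-monoʳ-≤ C′ Cₚ≤3a)
      ; prize-cover = ≤-reflexive (+-comm Pₚ P′)
      }

  module _ {R G PR PG : ℚ} where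
    open ≤-Reasoning

    Balance-detach-rooted : ∀ {cᵣ πᵣ} → 0ℚ ≤ πᵣ → cᵣ ≤ three * G → G ≤ three * a →
      Balance (R + G) R (cᵣ + G) (PR + PG) PR (πᵣ + PG)
    Balance-detach-rooted {cᵣ} {πᵣ} 0≤πᵣ cᵣ≤3G G≤3a = record
      { cost-key    = begin
          four * R + (cᵣ + G)          ≤⟨ +-monoʳ-≤ (four * R) (+-monoˡ-≤ G cᵣ≤3G) ⟩
          four * R + (three * G + G)   ≡⟨ solve (R ∷ G ∷ []) ringℚ ⟩
          four * (R + G)               ∎
      ; cost-drop   = +-monoʳ-≤ R G≤3a
      ; prize-cover = +-monoʳ-≤ PR (≤-trans (≤-reflexive (sym (+-identityˡ PG))) (+-monoˡ-≤ PG 0≤πᵣ))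
      }

module _ {A : Set} where

  open import Data.List.Relation.Unary.AllPairs using ([]; _∷_)
  open import Data.List.Relation.Binary.Sublist.Propositional using ([]; _∷_; _∷ʳ_)

  length-++-<ʳ : ∀ (xs ys zs : List A) → length ys ℕ.< length zs → length (xs ++ ys) ℕ.< length (xs ++ zs)
  length-++-<ʳ xs ys zs ys<zs rewrite length-++ xs {ys} | length-++ xs {zs} = ℕ.+-monoʳ-< (length xs) ys<zs

  length-++-<ˡ : ∀ (xs ys zs : List A) → length xs ℕ.< length ys → length (xs ++ zs) ℕ.< length (ys ++ zs)
  length-++-<ˡ xs ys zs xs<ys rewrite length-++ xs {zs} | length-++ ys {zs} = ℕ.+-monoˡ-< (length zs) xs<ys

  Unique-resp-⊇ : ∀ {xs ys : List A} → xs ⊆ ys → Unique ys → Unique xs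
  Unique-resp-⊇ []           []              = []
  Unique-resp-⊇ (y ∷ʳ xs⊆ys) (_ ∷ unique)    = Unique-resp-⊇ xs⊆ys unique
  Unique-resp-⊇ (refl ∷ xs⊆ys) (y∉ ∷ unique) = All-resp-⊆ xs⊆ys y∉ ∷ Unique-resp-⊇ xs⊆ys unique

  Unique-resp-↭ : ∀ {xs ys : List A} → xs ↭ ys → Unique xs → Unique ys
  Unique-resp-↭ xs↭ys = ↭ₛ.Unique-resp-↭ (setoid A) (↭⇒↭ₛ xs↭ys)

  Unique-++⁻ˡ : ∀ (xs ys : List A) → Unique (xs ++ ys) → Unique xs
  Unique-++⁻ˡ xs ys = Unique-resp-⊇ (++⁺ʳ ys ⊆-refl)

  Unique-++⁻ʳ : ∀ (xs ys : List A) → Unique (xs ++ ys) → Unique ys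
  Unique-++⁻ʳ xs ys = Unique-resp-⊇ (++⁺ˡ xs ⊆-refl)

  Unique-++⇒disjoint : ∀ (xs ys : List A) {z} → Unique (xs ++ ys) → z ∈ xs → z ∉ ys
  Unique-++⇒disjoint (x ∷ xs) ys unique        (here refl) z∈ys = Unique[x∷xs]⇒x∉xs unique (∈-++⁺ʳ xs z∈ys)
  Unique-++⇒disjoint (x ∷ xs) ys (_ ∷ unique) (there z∈xs) = Unique-++⇒disjoint xs ys unique z∈xs

  length-<-++-∷ : ∀ (xs : List A) y ys → length xs ℕ.< length (xs ++ y ∷ ys)
  length-<-++-∷ xs y ys = subst (length xs ℕ.<_) (sym (length-++-sucʳ xs y ys)) (s≤s (length-++-≤ˡ xs))

sumˡ : {A : Set} → (A → ℚ) → List A → ℚ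
sumˡ w = foldr (λ x s → w x + s) 0ℚ

_when_ : ℚ → Bool → ℚ
x when b = if b then x else 0ℚ

module _ {A : Set} where

  sumˡ-++ : ∀ w (xs ys : List A) → sumˡ w (xs ++ ys) ≡ sumˡ w xs + sumˡ w ys
  sumˡ-++ w []       ys = sym (+-identityˡ _)
  sumˡ-++ w (x ∷ xs) ys = trans (cong (w x +_) (sumˡ-++ w xs ys)) (sym (+-assoc (w x) _ _))

  sumˡ-cong : ∀ {f g : A → ℚ} → (∀ x → f x ≡ g x) → ∀ l → sumˡ f l ≡ sumˡ g l
  sumˡ-cong f≗g []      = refl
  sumˡ-cong f≗g (x ∷ l) = cong₂ _+_ (f≗g x) (sumˡ-cong f≗g l)

  sumˡ-+ : ∀ (f g : A → ℚ) l → sumˡ (λ x → f x + g x) l ≡ sumˡ f l + sumˡ g l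
  sumˡ-+ f g []      = refl
  sumˡ-+ f g (x ∷ l) = begin
    f x + g x + sumˡ (λ y → f y + g y) l   ≡⟨ cong (λ s → f x + g x + s) (sumˡ-+ f g l) ⟩
    f x + g x + (sumˡ f l + sumˡ g l)      ≡⟨ +-interchange (f x) (g x) (sumˡ f l) (sumˡ g l) ⟩
    f x + sumˡ f l + (g x + sumˡ g l)      ∎
    where open ≡-Reasoning

  sumˡ-zero : ∀ {f : A → ℚ} l → (∀ {x} → x ∈ l → f x ≡ 0ℚ) → sumˡ f l ≡ 0ℚ
  sumˡ-zero []      _     = refl
  sumˡ-zero (x ∷ l) zeros = cong₂ _+_ (zeros (here refl)) (sumˡ-zero l (λ x∈l → zeros (there x∈l)))

  module _ (_≟_ : DecidableEquality A) (w : A → ℚ) where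

    open import Data.List.Relation.Unary.AllPairs using (_∷_)

    sumˡ-indicator : ∀ {x l} → Unique l → x ∈ l → sumˡ (λ i → w i when does (i ≟ x)) l ≡ w x
    sumˡ-indicator {x} {i ∷ l} unique@(_ ∷ unique′) x∈ with i ≟ x | x∈
    ... | yes refl | _         = trans (cong (w i +_) (sumˡ-zero l others-vanish)) (+-identityʳ (w i))
      where
      others-vanish : ∀ {j} → j ∈ l → w j when does (j ≟ i) ≡ 0ℚ
      others-vanish {j} j∈l with j ≟ i
      ... | yes refl = contradiction j∈l (Unique[x∷xs]⇒x∉xs unique)
      ... | no  _    = refl
    ... | no  i≢x  | here x≡i  = contradiction (sym x≡i) i≢x
    ... | no  _    | there x∈l = trans (+-identityˡ _) (sumˡ-indicator unique′ x∈l)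

-- Rose trees

data Rose (V : Set) : Set where
  node : V → List (Rose V) → Rose V

module _ {V : Set} where

  root : Rose V → V
  root (node v _) = v

  mutual
    vertices : Rose V → List V
    vertices (node v ts) = v ∷ verticesᶠ ts

    verticesᶠ : List (Rose V) → List V
    verticesᶠ []       = []
    verticesᶠ (t ∷ ts) = vertices t ++ verticesᶠ ts

  mutual
    weightᵗ : (V → ℚ) → Rose V → ℚ
    weightᵗ w (node v ts) = w v + weightᶠ w ts

    weightᶠ : (V → ℚ) → List (Rose V) → ℚ
    weightᶠ w []       = 0ℚ
    weightᶠ w (t ∷ ts) = weightᵗ w t + weightᶠ w ts

  verticesᶠ-++ : ∀ ts us → verticesᶠ (ts ++ us) ≡ verticesᶠ ts ++ verticesᶠ us
  verticesᶠ-++ []       us = refl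
  verticesᶠ-++ (t ∷ ts) us = trans (cong (vertices t ++_) (verticesᶠ-++ ts us)) (sym (++-assoc (vertices t) _ _))

  weightᶠ-++ : ∀ w ts us → weightᶠ w (ts ++ us) ≡ weightᶠ w ts + weightᶠ w us
  weightᶠ-++ w []       us = sym (+-identityˡ _)
  weightᶠ-++ w (t ∷ ts) us = trans (cong (weightᵗ w t +_) (weightᶠ-++ w ts us)) (sym (+-assoc (weightᵗ w t) _ _))

  mutual
    weightᵗ≡sumˡ : ∀ w t → weightᵗ w t ≡ sumˡ w (vertices t)
    weightᵗ≡sumˡ w (node v ts) = cong (w v +_) (weightᶠ≡sumˡ w ts)

    weightᶠ≡sumˡ : ∀ w ts → weightᶠ w ts ≡ sumˡ w (verticesᶠ ts)
    weightᶠ≡sumˡ w []       = refl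
    weightᶠ≡sumˡ w (t ∷ ts) =
      trans (cong₂ _+_ (weightᵗ≡sumˡ w t) (weightᶠ≡sumˡ w ts)) (sym (sumˡ-++ w (vertices t) (verticesᶠ ts)))

  size : Rose V → ℕ
  size t = length (vertices t)

  verticesᶠ-⊆-++ˡ : ∀ ts us → verticesᶠ ts ⊆ verticesᶠ (ts ++ us)
  verticesᶠ-⊆-++ˡ ts us = subst (verticesᶠ ts ⊆_) (sym (verticesᶠ-++ ts us)) (++⁺ʳ (verticesᶠ us) ⊆-refl)

  verticesᶠ-⊆-++ʳ : ∀ ts us → verticesᶠ us ⊆ verticesᶠ (ts ++ us)
  verticesᶠ-⊆-++ʳ ts us = subst (verticesᶠ us ⊆_) (sym (verticesᶠ-++ ts us)) (++⁺ˡ (verticesᶠ ts) ⊆-refl)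

  verticesᶠ-<-++-∷ : ∀ ts u us vs → length (verticesᶠ ts) ℕ.< length (verticesᶠ (ts ++ node u us ∷ vs))
  verticesᶠ-<-++-∷ ts u us vs =
    subst (λ xs → length (verticesᶠ ts) ℕ.< length xs) (sym (verticesᶠ-++ ts (node u us ∷ vs)))
    (length-<-++-∷ (verticesᶠ ts) u (verticesᶠ us ++ verticesᶠ vs))

  module _ {w : V → ℚ} (0≤w : ∀ v → 0ℚ ≤ w v) where
    mutual
      weightᵗ-nonNeg : ∀ t → 0ℚ ≤ weightᵗ w t
      weightᵗ-nonNeg (node v ts) = +-mono-≤ (0≤w v) (weightᶠ-nonNeg ts)

      weightᶠ-nonNeg : ∀ ts → 0ℚ ≤ weightᶠ w ts
      weightᶠ-nonNeg []       = ≤-refl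
      weightᶠ-nonNeg (t ∷ ts) = +-mono-≤ (weightᵗ-nonNeg t) (weightᶠ-nonNeg ts)

module _ {V : Set} (_~_ : V → V → Set) where

  data Embedded : Rose V → Set

  Hangs : V → Rose V → Set
  Hangs v t = v ~ root t × Embedded t

  data Embedded where
    node : ∀ {v ts} → All (Hangs v) ts → Embedded (node v ts)

-- Cutting a piece off a tree

module Splitting {V : Set} (_~_ : V → V → Set) (c π : V → ℚ)
  (0≤c : ∀ v → 0ℚ ≤ c v) (0≤π : ∀ v → 0ℚ ≤ π v)
  {B : ℚ} (0≤B : 0ℚ ≤ B) (2c≤B : ∀ v → two * c v ≤ B) where

  open import Data.List.Relation.Unary.All using ([]; _∷_)
  open import Data.List.Relation.Binary.Sublist.Propositional using (_∷_; _∷ʳ_)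

  -- Opaque, since unfolding a makes normalising the goals below very slow.
  opaque
    a : ℚ
    a = B * (ℤ.+ 1 / 4)

    four*a≡B : four * a ≡ B
    four*a≡B = four*[x*¼]≡x B

  0≤a : 0ℚ ≤ a
  0≤a = *-cancelˡ-≤-pos four (≤-trans (≤-reflexive (*-zeroʳ four)) (subst (0ℚ ≤_) (sym four*a≡B) 0≤B))

  c≤2a : ∀ v → c v ≤ two * a
  c≤2a v = *-cancelˡ-≤-pos two (subst (two * c v ≤_) (sym (trans (two*[two*x]≡four*x a) four*a≡B)) (2c≤B v))

  a≤x⇒B≤four*x : ∀ {x} → a ≤ x → B ≤ four * x
  a≤x⇒B≤four*x {x} a≤x = subst (_≤ four * x) four*a≡B (*-monoˡ-≤-nonNeg four a≤x)

  x≤four*a⇒x≤B : ∀ {x} → x ≤ four * a → x ≤ B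
  x≤four*a⇒x≤B {x} = subst (x ≤_) four*a≡B

  C P : Rose V → ℚ
  C = weightᵗ c
  P = weightᵗ π

  Cᶠ Pᶠ : List (Rose V) → ℚ
  Cᶠ = weightᶠ c
  Pᶠ = weightᶠ π

  Light : Rose V → Set
  Light t = C t < a

  record Cut (v : V) (ts : List (Rose V)) : Set where
    field
      piece          : Rose V
      rest           : List (Rose V)
      balance        : Balance a (Cᶠ ts) (Cᶠ rest) (C piece) (Pᶠ ts) (Pᶠ rest) (P piece)
      piece-large    : a ≤ C piece
      piece-small    : C piece ≤ four * a
      piece-⊆        : vertices piece ⊆ vertices (node v ts)
      rest-⊆         : verticesᶠ rest ⊆ verticesᶠ ts
      rest-shorter   : length (verticesᶠ rest) ℕ.< length (verticesᶠ ts)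
      piece-embedded : Embedded _~_ piece
      rest-hangs     : All (Hangs _~_ v) rest

  cut-whole : ∀ {v t ts} → Hangs _~_ v t → All (Hangs _~_ v) ts → a ≤ C t → C t ≤ three * a →
    Cut v (t ∷ ts)
  cut-whole {v} {t@(node u us)} {ts} (_ , t-embedded) hangs a≤t t≤3a = record
    { piece          = t
    ; rest           = ts
    ; balance        = Balance-detach a (weightᵗ-nonNeg 0≤c t) t≤3a
    ; piece-large    = a≤t
    ; piece-small    = ≤-trans t≤3a (three*x≤four*x 0≤a)
    ; piece-⊆        = v ∷ʳ ++⁺ʳ (verticesᶠ ts) ⊆-refl
    ; rest-⊆         = ++⁺ˡ (vertices t) ⊆-refl
    ; rest-shorter   = s≤s (length-++-≤ʳ (verticesᶠ ts) {verticesᶠ us})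
    ; piece-embedded = t-embedded
    ; rest-hangs     = hangs
    }

  cut-tail : ∀ {v t ts} → Hangs _~_ v t → Cut v ts → Cut v (t ∷ ts)
  cut-tail {v} {t} {ts} hang κ = record
    { piece          = piece
    ; rest           = t ∷ rest
    ; balance        = Balance-shiftˡ a (C t) (P t) balance
    ; piece-large    = piece-large
    ; piece-small    = piece-small
    ; piece-⊆        = ⊆-trans piece-⊆ (refl ∷ ++⁺ˡ (vertices t) ⊆-refl)
    ; rest-⊆         = ++⁺ ⊆-refl rest-⊆
    ; rest-shorter   = length-++-<ʳ (vertices t) (verticesᶠ rest) (verticesᶠ ts) rest-shorter
    ; piece-embedded = piece-embedded
    ; rest-hangs     = hang ∷ rest-hangs
    }
    where open Cut κ

  cut-inside : ∀ {v u us ts} → v ~ u → All (Hangs _~_ v) ts → Cut u us → Cut v (node u us ∷ ts)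
  cut-inside {v} {u} {us} {ts} v~u hangs κ = record
    { piece          = piece
    ; rest           = node u rest ∷ ts
    ; balance        = Balance-shiftʳ a (Cᶠ ts) (Pᶠ ts) (Balance-shiftˡ a (c u) (π u) balance)
    ; piece-large    = piece-large
    ; piece-small    = piece-small
    ; piece-⊆        = v ∷ʳ ++⁺ʳ (verticesᶠ ts) piece-⊆
    ; rest-⊆         = ++⁺ (refl ∷ rest-⊆) ⊆-refl
    ; rest-shorter   = s≤s (length-++-<ˡ (verticesᶠ rest) (verticesᶠ us) (verticesᶠ ts) rest-shorter)
    ; piece-embedded = piece-embedded
    ; rest-hangs     = (v~u , node rest-hangs) ∷ hangs
    }
    where open Cut κ

  light-suffix : ∀ ts → All Light ts → a < Cᶠ ts →
    ∃ λ ys → ∃₂ λ z zs → ts ≡ ys ++ z ∷ zs × a < Cᶠ (z ∷ zs) × Cᶠ (z ∷ zs) < two * a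
  light-suffix []       []             a<0   = contradiction (≤-<-trans 0≤a a<0) (<-irrefl refl)
  light-suffix (t ∷ ts) (t-light ∷ light) a<t+ts with a <? Cᶠ ts
  ... | yes a<ts = let ys , z , zs , ts≡ , large , small = light-suffix ts light a<ts
                   in t ∷ ys , z , zs , cong (t ∷_) ts≡ , large , small
  ... | no  ts≤a = [] , t , ts , refl , a<t+ts , x<a⇒y≤a⇒x+y<two*a t-light (≮⇒≥ ts≤a)

  cut-suffix : ∀ {v} ys z zs → All (Hangs _~_ v) (ys ++ z ∷ zs) → a < Cᶠ (z ∷ zs) → Cᶠ (z ∷ zs) < two * a →
    Cut v (ys ++ z ∷ zs)
  cut-suffix {v} ys z@(node u us) zs hangs a<G G<2a = record
    { piece          = node v (z ∷ zs)
    ; rest           = ys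
    ; balance        = subst₂ (λ C⁺ P⁺ → Balance a C⁺ (Cᶠ ys) (C (node v (z ∷ zs))) P⁺ (Pᶠ ys) (P (node v (z ∷ zs))))
                         (sym (weightᶠ-++ c ys (z ∷ zs))) (sym (weightᶠ-++ π ys (z ∷ zs)))
                         (Balance-detach-rooted a (0≤π v) cᵥ≤3G (≤-trans (<⇒≤ G<2a) (two*x≤three*x 0≤a)))
    ; piece-large    = ≤-trans (<⇒≤ a<G) (x≤y+x (0≤c v))
    ; piece-small    = x≤two*a⇒y≤two*a⇒x+y≤four*a {a} (c≤2a v) (<⇒≤ G<2a)
    ; piece-⊆        = refl ∷ verticesᶠ-⊆-++ʳ ys (z ∷ zs)
    ; rest-⊆         = verticesᶠ-⊆-++ˡ ys (z ∷ zs)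
    ; rest-shorter   = verticesᶠ-<-++-∷ ys u us zs
    ; piece-embedded = node (Allₚ.++⁻ʳ ys hangs)
    ; rest-hangs     = Allₚ.++⁻ˡ ys hangs
    }
    where
    G : ℚ
    G = Cᶠ (z ∷ zs)
    cᵥ≤3G : c v ≤ three * G
    cᵥ≤3G = ≤-trans (c≤2a v)
      (≤-trans (*-monoˡ-≤-nonNeg two (<⇒≤ a<G)) (two*x≤three*x (≤-trans 0≤a (<⇒≤ a<G))))

  cut-root : ∀ {v ts} → All (Hangs _~_ v) ts → All Light ts → three * a < C (node v ts) → Cut v ts
  cut-root {v} {ts} hangs light heavy with light-suffix ts light (three*a<x+y⇒x≤two*a⇒a<y heavy (c≤2a v))
  ... | ys , z , zs , refl , a<G , G<2a = cut-suffix ys z zs hangs a<G G<2a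

  mutual
    cut : ∀ {v ts} → All (Hangs _~_ v) ts → three * a < C (node v ts) → Cut v ts
    cut hangs heavy with cutᶠ hangs
    ... | inj₁ κ     = κ
    ... | inj₂ light = cut-root hangs light heavy

    cutᶠ : ∀ {v ts} → All (Hangs _~_ v) ts → Cut v ts ⊎ All Light ts
    cutᶠ [] = inj₂ []
    cutᶠ {ts = t ∷ _} (hang@(v~u , node hangs′) ∷ hangs) with C t <? a
    ... | yes t-light = Sum.map (cut-tail hang) (t-light ∷_) (cutᶠ hangs)
    ... | no  t-large with C t ≤? three * a
    ...   | yes t≤3a = inj₁ (cut-whole hang hangs (≮⇒≥ t-large) t≤3a)
    ...   | no  t>3a = inj₁ (cut-inside v~u hangs (cut hangs′ (≰⇒> t>3a)))

  module _ (p q : ℚ) where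

    record Piece (t : Rose V) : Set where
      field
        tree          : Rose V
        tree-⊆        : vertices tree ⊆ vertices t
        tree-embedded : Embedded _~_ tree
        tree-large    : B ≤ four * C tree
        tree-small    : C tree ≤ B
        tree-rich     : p * C tree ≤ four * P tree * q

    Piece-⊆ : ∀ {s t} → vertices s ⊆ vertices t → Piece s → Piece t
    Piece-⊆ s⊆t found = record { Piece found ; tree-⊆ = ⊆-trans (Piece.tree-⊆ found) s⊆t }

    module _ (0≤p : 0ℚ ≤ p) (0≤q : 0ℚ ≤ q) where
      mutual
        find-piece : ∀ t → Acc ℕ._<_ (size t) → Embedded _~_ t → a ≤ C t → p * C t ≤ q * P t → Piece t
        find-piece t _ t-embedded t-large t-rich with C t ≤? four * a
        ... | yes t-small = record
          { tree          = t
          ; tree-⊆        = ⊆-refl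
          ; tree-embedded = t-embedded
          ; tree-large    = a≤x⇒B≤four*x t-large
          ; tree-small    = x≤four*a⇒x≤B t-small
          ; tree-rich     = ≤-trans t-rich (x*y≤four*y*x 0≤q (weightᵗ-nonNeg 0≤π t))
          }
        find-piece (node v ts) accessible (node hangs) _ t-rich | no t-heavy =
          find-piece-in-cut accessible (≰⇒> t-heavy) t-rich
            (cut hangs (≤-<-trans (three*x≤four*x 0≤a) (≰⇒> t-heavy)))

        find-piece-in-cut : ∀ {v ts} → Acc ℕ._<_ (size (node v ts)) → four * a < C (node v ts) →
          p * C (node v ts) ≤ q * P (node v ts) → Cut v ts → Piece (node v ts)
        find-piece-in-cut {v} (acc smaller) heavy rich κ with p * C (Cut.piece κ) ≤? four * P (Cut.piece κ) * q
        ... | yes piece-rich = record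
          { tree          = piece
          ; tree-⊆        = piece-⊆
          ; tree-embedded = piece-embedded
          ; tree-large    = a≤x⇒B≤four*x piece-large
          ; tree-small    = x≤four*a⇒x≤B piece-small
          ; tree-rich     = piece-rich
          }
          where open Cut κ
        ... | no piece-poor = Piece-⊆ (refl ∷ rest-⊆)
          (find-piece (node v rest) (smaller (s≤s rest-shorter)) (node rest-hangs)
            (four*a<x⇒x≤y+three*a⇒a≤y heavy cost-drop)
            (ratio-inherited 0≤p 0≤q cost-key prize-cover rich (≰⇒> piece-poor)))
          where
          open Cut κ
          open Balance (Balance-shiftˡ a (c v) (π v) balance)

  piece-of-tree : ∀ t → Embedded _~_ t → B ≤ two * C t → Piece (P t) (C t) t
  piece-of-tree t embedded B≤2C = find-piece (P t) (C t) (weightᵗ-nonNeg 0≤π t) (weightᵗ-nonNeg 0≤c t)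
    t (<-wellFounded _) embedded a≤C (≤-reflexive (*-comm (P t) (C t)))
    where
    a≤C : a ≤ C t
    a≤C = *-cancelˡ-≤-pos four (begin
      four * a    ≡⟨ four*a≡B ⟩
      B           ≤⟨ B≤2C ⟩
      two * C t   ≤⟨ two*x≤four*x (weightᵗ-nonNeg 0≤c t) ⟩
      four * C t  ∎)
      where open ≤-Reasoning

-- Vertex sets, walks and connectivity

module _ {n : ℕ} where

  open import Data.List.Membership.DecPropositional (_≟ᶠ_ {n}) using (_∈?_)

  toSubset : List (Fin n) → Subset n
  toSubset xs = tabulate (λ i → does (i ∈? xs))

  ∈-toSubset⁺ : ∀ {i xs} → i ∈ xs → i ∈ₛ toSubset xs
  ∈-toSubset⁺ {i} {xs} i∈xs = lookup⇒[]= i _ (trans (lookup∘tabulate _ i) (dec-true (i ∈? xs) i∈xs))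

  ∈-toSubset⁻ : ∀ {i xs} → i ∈ₛ toSubset xs → i ∈ xs
  ∈-toSubset⁻ {i} {xs} i∈S
    with i ∈? xs | trans (sym (lookup∘tabulate (λ j → does (j ∈? xs)) i)) ([]=⇒lookup i∈S)
  ... | yes i∈xs | _ = i∈xs
  ... | no  _    | ()

  -- weight w S is definitionally sumˡ (λ i → w i when lookup S i) (allFin n).
  weight-toSubset : ∀ w {xs} → Unique xs → weight w (toSubset xs) ≡ sumˡ w xs
  weight-toSubset w {xs} unique =
    trans (sumˡ-cong (λ i → cong (w i when_) (lookup∘tabulate _ i)) (allFin n)) (sumˡ-∈? unique)
    where
    open import Data.List.Relation.Unary.AllPairs using ([]; _∷_)

    sumˡ-∈? : ∀ {xs} → Unique xs → sumˡ (λ i → w i when does (i ∈? xs)) (allFin n) ≡ sumˡ w xs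
    sumˡ-∈? []                               = sumˡ-zero (allFin n) (λ _ → refl)
    sumˡ-∈? {x ∷ xs} unique@(_ ∷ unique′) = begin
      sumˡ (λ i → w i when does (i ∈? x ∷ xs)) (allFin n)
        ≡⟨ sumˡ-cong split (allFin n) ⟩
      sumˡ (λ i → (w i when does (i ≟ᶠ x)) + (w i when does (i ∈? xs))) (allFin n)
        ≡⟨ sumˡ-+ (λ i → w i when does (i ≟ᶠ x)) (λ i → w i when does (i ∈? xs)) (allFin n) ⟩
      sumˡ (λ i → w i when does (i ≟ᶠ x)) (allFin n) + sumˡ (λ i → w i when does (i ∈? xs)) (allFin n)
        ≡⟨ cong₂ _+_ (sumˡ-indicator _≟ᶠ_ w (allFin⁺ n) (∈-allFin x)) (sumˡ-∈? unique′) ⟩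
      w x + sumˡ w xs
        ∎
      where
      open ≡-Reasoning
      split : ∀ i → w i when does (i ∈? x ∷ xs) ≡ (w i when does (i ≟ᶠ x)) + (w i when does (i ∈? xs))
      split i with i ≟ᶠ x | i ∈? xs
      ... | yes refl | yes i∈xs = contradiction i∈xs (Unique[x∷xs]⇒x∉xs unique)
      ... | yes _    | no  _    = sym (+-identityʳ _)
      ... | no  _    | yes _    = sym (+-identityˡ _)
      ... | no  _    | no  _    = refl

  weight-complete : ∀ w {xs} → (∀ i → i ∈ xs) → weight w (replicate n true) ≡ weight w (toSubset xs)
  weight-complete w {xs} complete = sumˡ-cong (λ i → cong (w i when_) (all-inside i)) (allFin n)
    where
    all-inside : ∀ i → lookup (replicate n true) i ≡ lookup (toSubset xs) i
    all-inside i = trans (lookup-replicate i true)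
      (sym (trans (lookup∘tabulate _ i) (dec-true (i ∈? xs) (complete i))))

  weight-vertices : ∀ w {t} → Unique (vertices t) → weight w (toSubset (vertices t)) ≡ weightᵗ w t
  weight-vertices w {t} unique = trans (weight-toSubset w unique) (sym (weightᵗ≡sumˡ w t))

module _ {n : ℕ} (G : SimpleGraph n) where

  open import Data.List.Membership.DecPropositional (_≟ᶠ_ {n}) using (_∈?_)
  open import Data.List.Relation.Unary.All using (_∷_)

  Adj-sym : ∀ {u v} → Adj G u v → Adj G v u
  Adj-sym {u} {v} u~v = trans (sym (SimpleGraph.sym G u v)) u~v

  module _ {S : Subset n} where

    walk-start : ∀ {u v} → WalkIn G S u v → u ∈ₛ S
    walk-start (here u∈S)     = u∈S
    walk-start (step u∈S _ _) = u∈S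

    _++ʷ_ : ∀ {u v w} → WalkIn G S u v → WalkIn G S v w → WalkIn G S u w
    here _          ++ʷ walk′ = walk′
    step u∈S u~ walk ++ʷ walk′ = step u∈S u~ (walk ++ʷ walk′)

    reverseʷ : ∀ {u v} → WalkIn G S u v → WalkIn G S v u
    reverseʷ (here u∈S)          = here u∈S
    reverseʷ (step u∈S u~w walk) = reverseʷ walk ++ʷ step (walk-start walk) (Adj-sym u~w) (here u∈S)

    leaving-edge : ∀ (L : List (Fin n)) {u v} → WalkIn G S u v → u ∈ L → v ∉ L →
      ∃₂ λ y z → y ∈ L × z ∉ L × Adj G y z
    leaving-edge L (here _)                         u∈L u∉L = contradiction u∈L u∉L
    leaving-edge L (step {u} {w} _ u~w walk) u∈L v∉L with w ∈? L
    ... | yes w∈L = leaving-edge L walk w∈L v∉L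
    ... | no  w∉L = u , w , u∈L , w∉L , u~w

    mutual
      walk-from-root : ∀ {t x} → Embedded (Adj G) t → (∀ {y} → y ∈ vertices t → y ∈ₛ S) →
        x ∈ vertices t → WalkIn G S (root t) x
      walk-from-root (node hangs) ⊆S (here refl) = here (⊆S (here refl))
      walk-from-root (node hangs) ⊆S (there x∈)  = walk-into hangs (⊆S (here refl)) (λ y∈ → ⊆S (there y∈)) x∈

      walk-into : ∀ {v ts x} → All (Hangs (Adj G) v) ts → v ∈ₛ S → (∀ {y} → y ∈ verticesᶠ ts → y ∈ₛ S) →
        x ∈ verticesᶠ ts → WalkIn G S v x
      walk-into {ts = t ∷ ts} ((v~t , t-embedded) ∷ hangs) v∈S ⊆S x∈ with ∈-++⁻ (vertices t) x∈
      ... | inj₁ x∈t  = step v∈S v~t (walk-from-root t-embedded (λ y∈ → ⊆S (∈-++⁺ˡ y∈)) x∈t)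
      ... | inj₂ x∈ts = walk-into hangs v∈S (λ y∈ → ⊆S (∈-++⁺ʳ (vertices t) y∈)) x∈ts

  Embedded⇒connected : ∀ {t} → Embedded (Adj G) t → ConnectedOn G (toSubset (vertices t))
  Embedded⇒connected {t@(node r _)} embedded =
    (r , ∈-toSubset⁺ {xs = vertices t} (here refl)) ,
    λ u v u∈ v∈ → reverseʷ (from-root (∈-toSubset⁻ u∈)) ++ʷ from-root (∈-toSubset⁻ v∈)
    where
    from-root : ∀ {x} → x ∈ vertices t → WalkIn G (toSubset (vertices t)) r x
    from-root = walk-from-root embedded ∈-toSubset⁺

-- Spanning trees

module _ {V : Set} (_≟_ : DecidableEquality V) (u x : V) where

  open import Data.List.Relation.Unary.All using ([]; _∷_)
  open import Data.List.Relation.Unary.AllPairs using (_∷_)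

  mutual
    graft : Rose V → Rose V
    graft (node v ts) with v ≟ u
    ... | yes _ = node v (node x [] ∷ graftᶠ ts)
    ... | no  _ = node v (graftᶠ ts)

    graftᶠ : List (Rose V) → List (Rose V)
    graftᶠ []       = []
    graftᶠ (t ∷ ts) = graft t ∷ graftᶠ ts

  root-graft : ∀ t → root (graft t) ≡ root t
  root-graft (node v ts) with v ≟ u
  ... | yes _ = refl
  ... | no  _ = refl

  module _ {_~_ : V → V → Set} (u~x : u ~ x) where
    mutual
      graft-embedded : ∀ {t} → Embedded _~_ t → Embedded _~_ (graft t)
      graft-embedded {node v ts} (node hangs) with v ≟ u
      ... | yes refl = node ((u~x , node []) ∷ graftᶠ-hangs hangs)
      ... | no  _    = node (graftᶠ-hangs hangs)

      graftᶠ-hangs : ∀ {v ts} → All (Hangs _~_ v) ts → All (Hangs _~_ v) (graftᶠ ts)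
      graftᶠ-hangs []                      = []
      graftᶠ-hangs {v} {t ∷ _} ((v~t , t-emb) ∷ hangs) =
        (subst (v ~_) (sym (root-graft t)) v~t , graft-embedded t-emb) ∷ graftᶠ-hangs hangs

  mutual
    vertices-graft-∉ : ∀ t → u ∉ vertices t → vertices (graft t) ≡ vertices t
    vertices-graft-∉ (node v ts) u∉ with v ≟ u
    ... | yes refl = contradiction (here refl) u∉
    ... | no  _    = cong (v ∷_) (verticesᶠ-graftᶠ-∉ ts (λ u∈ → u∉ (there u∈)))

    verticesᶠ-graftᶠ-∉ : ∀ ts → u ∉ verticesᶠ ts → verticesᶠ (graftᶠ ts) ≡ verticesᶠ ts
    verticesᶠ-graftᶠ-∉ []       _  = refl
    verticesᶠ-graftᶠ-∉ (t ∷ ts) u∉ = cong₂ _++_ (vertices-graft-∉ t (λ u∈ → u∉ (∈-++⁺ˡ u∈)))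
                                               (verticesᶠ-graftᶠ-∉ ts (λ u∈ → u∉ (∈-++⁺ʳ (vertices t) u∈)))

  mutual
    vertices-graft-↭ : ∀ t → u ∈ vertices t → Unique (vertices t) → vertices (graft t) ↭ x ∷ vertices t
    vertices-graft-↭ (node v ts) u∈ unique@(_ ∷ unique′) with v ≟ u
    ... | yes refl = subst (λ vs → v ∷ x ∷ vs ↭ x ∷ v ∷ verticesᶠ ts)
                       (sym (verticesᶠ-graftᶠ-∉ ts (Unique[x∷xs]⇒x∉xs unique))) (swap v x ↭-refl)
    ... | no  v≢u with u∈
    ...   | here u≡v   = contradiction (sym u≡v) v≢u
    ...   | there u∈ts = ↭-trans (prep v (verticesᶠ-graftᶠ-↭ ts u∈ts unique′)) (swap v x ↭-refl)

    verticesᶠ-graftᶠ-↭ : ∀ ts → u ∈ verticesᶠ ts → Unique (verticesᶠ ts) →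
      verticesᶠ (graftᶠ ts) ↭ x ∷ verticesᶠ ts
    verticesᶠ-graftᶠ-↭ (t ∷ ts) u∈ unique with ∈-++⁻ (vertices t) u∈
    ... | inj₁ u∈t  = subst (λ vs → vertices (graft t) ++ vs ↭ x ∷ vertices t ++ verticesᶠ ts)
                        (sym (verticesᶠ-graftᶠ-∉ ts (Unique-++⇒disjoint (vertices t) _ unique u∈t)))
                        (↭.++⁺ʳ (verticesᶠ ts) (vertices-graft-↭ t u∈t (Unique-++⁻ˡ (vertices t) _ unique)))
    ... | inj₂ u∈ts = subst (λ vs → vs ++ verticesᶠ (graftᶠ ts) ↭ x ∷ vertices t ++ verticesᶠ ts)
                        (sym (vertices-graft-∉ t (λ u∈t → Unique-++⇒disjoint (vertices t) _ unique u∈t u∈ts)))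
                        (↭-trans (↭.++⁺ˡ (vertices t) (verticesᶠ-graftᶠ-↭ ts u∈ts (Unique-++⁻ʳ (vertices t) _ unique)))
                                 (↭.shift x (vertices t) (verticesᶠ ts)))

module _ {A : Set} (_≟_ : DecidableEquality A) where

  open import Data.List.Membership.DecPropositional _≟_ using (_∈?_)

  missing : List A → List A → ℕ
  missing []      xs = 0
  missing (i ∷ l) xs = (if does (i ∈? xs) then 0 else 1) ℕ.+ missing l xs

  missing-antimono : ∀ {xs ys} → (∀ {i} → i ∈ xs → i ∈ ys) → ∀ l → missing l ys ℕ.≤ missing l xs
  missing-antimono xs⊆ys []      = z≤n
  missing-antimono {xs} {ys} xs⊆ys (i ∷ l) with i ∈? xs | i ∈? ys
  ... | yes i∈xs | no i∉ys = contradiction (xs⊆ys i∈xs) i∉ys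
  ... | yes _    | yes _   = missing-antimono xs⊆ys l
  ... | no  _    | yes _   = ℕ.m≤n⇒m≤1+n (missing-antimono xs⊆ys l)
  ... | no  _    | no  _   = s≤s (missing-antimono xs⊆ys l)

  missing-< : ∀ {xs ys y} → (∀ {i} → i ∈ xs → i ∈ ys) → y ∉ xs → y ∈ ys → ∀ {l} → y ∈ l →
    missing l ys ℕ.< missing l xs
  missing-< {xs} {ys} xs⊆ys y∉xs y∈ys {i ∷ l} (here refl) with i ∈? xs | i ∈? ys
  ... | yes i∈xs | _       = contradiction i∈xs y∉xs
  ... | no  _    | yes _   = s≤s (missing-antimono xs⊆ys l)
  ... | no  _    | no i∉ys = contradiction y∈ys i∉ys
  missing-< {xs} {ys} xs⊆ys y∉xs y∈ys {i ∷ l} (there y∈l) with i ∈? xs | i ∈? ys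
  ... | yes i∈xs | no i∉ys = contradiction (xs⊆ys i∈xs) i∉ys
  ... | yes _    | yes _   = missing-< xs⊆ys y∉xs y∈ys y∈l
  ... | no  _    | yes _   = ℕ.m≤n⇒m≤1+n (missing-< xs⊆ys y∉xs y∈ys y∈l)
  ... | no  _    | no  _   = s≤s (missing-< xs⊆ys y∉xs y∈ys y∈l)

module _ {n : ℕ} (G : SimpleGraph n) where

  open import Data.List.Membership.DecPropositional (_≟ᶠ_ {n}) using (_∈?_)
  open import Data.List.Relation.Unary.All using ([])
  open import Data.List.Relation.Unary.AllPairs using ([]; _∷_)

  record SpanningTree : Set where
    field
      tree     : Rose (Fin n)
      embedded : Embedded (Adj G) tree
      unique   : Unique (vertices tree)
      complete : ∀ i → i ∈ vertices tree

  module _ (connected : ConnectedOn G (replicate n true)) where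

    grow : ∀ t → Acc ℕ._<_ (missing _≟ᶠ_ (allFin n) (vertices t)) → Embedded (Adj G) t → Unique (vertices t) →
      SpanningTree
    grow t@(node r _) (acc smaller) embedded unique with all? (_∈? vertices t)
    ... | yes complete = record { tree = t ; embedded = embedded ; unique = unique ; complete = complete }
    ... | no incomplete with ¬∀⟶∃¬ n _ (_∈? vertices t) incomplete
    ...   | y , y∉t with leaving-edge G (vertices t) (proj₂ connected r y ∈⊤ ∈⊤) (here refl) y∉t
    ...     | u , x , u∈t , x∉t , u~x =
      grow (graft _≟ᶠ_ u x t) (smaller fewer-missing) (graft-embedded _≟ᶠ_ u x u~x embedded)
        (Unique-resp-↭ (↭-sym grafted↭) (¬Any⇒All¬ (vertices t) x∉t ∷ unique))
      where
      grafted↭ : vertices (graft _≟ᶠ_ u x t) ↭ x ∷ vertices t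
      grafted↭ = vertices-graft-↭ _≟ᶠ_ u x t u∈t unique
      fewer-missing :
        missing _≟ᶠ_ (allFin n) (vertices (graft _≟ᶠ_ u x t)) ℕ.< missing _≟ᶠ_ (allFin n) (vertices t)
      fewer-missing = missing-< _≟ᶠ_ (λ i∈ → ↭.∈-resp-↭ (↭-sym grafted↭) (there i∈)) x∉t
        (↭.∈-resp-↭ (↭-sym grafted↭) (here refl)) (∈-allFin x)

    spanning-tree : SpanningTree
    spanning-tree = grow (node r []) (<-wellFounded _) (node []) ([] ∷ [])
      where r = proj₁ (proj₁ connected)

lemma4 : {n : ℕ} (T : SimpleGraph n) → IsTree T →
    (c π : Fin n → ℚ) → (∀ v → 0ℚ ≤ c v) → (∀ v → 0ℚ ≤ π v) →
    0ℚ < weight c (replicate n true) →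
    (B : ℚ) → B ≤ two * weight c (replicate n true) →
    (∀ v → two * c v ≤ B) →
    Σ (Subset n) λ S → ConnectedOn T S ×
      (weight π (replicate n true) * weight c S
         ≤ four * weight π S * weight c (replicate n true)) ×
      (B ≤ four * weight c S) × (weight c S ≤ B)
lemma4 {n} T (connected , _) c π 0≤c 0≤π _ B B≤2total 2c≤B =
  toSubset (vertices tree) , Embedded⇒connected T tree-embedded ,
  subst₂ _≤_ (cong₂ _*_ (sym (weight-T₀ π)) (sym (weight-tree c)))
             (cong₂ (λ Pₛ total → four * Pₛ * total) (sym (weight-tree π)) (sym (weight-T₀ c))) tree-rich ,
  subst (λ Cₛ → B ≤ four * Cₛ) (sym (weight-tree c)) tree-large ,
  subst (_≤ B) (sym (weight-tree c)) tree-small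
  where
  open SpanningTree (spanning-tree T connected) renaming (tree to T₀; unique to T₀-unique)

  0≤B : 0ℚ ≤ B
  0≤B = ≤-trans (0≤x⇒0≤y⇒0≤x*y (nonNegative⁻¹ two) (0≤c (root T₀))) (2c≤B (root T₀))

  weight-T₀ : ∀ w → weight w (replicate n true) ≡ weightᵗ w T₀
  weight-T₀ w = trans (weight-complete w complete) (weight-vertices w T₀-unique)

  open Splitting (Adj T) c π 0≤c 0≤π 0≤B 2c≤B
  open Piece (piece-of-tree T₀ embedded (subst (λ total → B ≤ two * total) (weight-T₀ c) B≤2total))

  weight-tree : ∀ w → weight w (toSubset (vertices tree)) ≡ weightᵗ w tree
  weight-tree w = weight-vertices w (Unique-resp-⊇ tree-⊆ T₀-unique)
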